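{- Let $\mathcal{E}$ be a $\lor$-free set of extension axioms and $A,B$ eDT formulas (over the extension variables of $\mathcal{E}$). Then $A\succeq_\mathcal{E} B$ if and only if $\mathrm{unf}_\mathcal{E}(A)=\mathrm{unf}_\mathcal{E}(B)$.
   Context: Propositional variables $p,q,\dots$ and disjoint extension variables $e_0,e_1,\dots$. eDT formulas: $A::=0\mid1\mid ApB\mid e_i$ ($p$ propositional); DT formulas are those without extension variables. A $\lor$-free set of extension axioms $\mathcal{E}=\{e_i\leftrightarrow E_i\}_{i<n}$ has each $E_i$ an eDT formula mentioning only $e_0,\dots,e_{i-1}$. Unfolding: the DT formula $\mathrm{unf}_\mathcal{E}(A)$ is defined by well-founded recursion: $\mathrm{unf}(0)=0$, $\mathrm{unf}(1)=1$, $\mathrm{unf}(ApB)=\mathrm{unf}(A)\,p\,\mathrm{unf}(B)$, $\mathrm{unf}(e_i)=\mathrm{unf}(E_i)$. Simulation: $A\succeq_\mathcal{E}B$ (for eNDT formulas, $\lor$ allowed) is the smallest relation such that: $A\succeq A$; if $A\succeq C$ and $A\succeq D$ then $A\succeq C\lor D$; if $A\succeq E_i$ then $A\succeq e_i$; if $A\succeq C$ and $B\succeq D$ then $ApB\succeq CpD$; if $A_j\succeq B$ for some $j\in\{0,1\}$ then $A_0\lor A_1\succeq B$; if $E_i\succeq B$ then $e_i\succeq B$. -}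

module Defs where

open import Data.Nat using (ℕ; zero; suc)
open import Data.Fin using (Fin; zero; suc; inject₁)
open import Data.Maybe using (Maybe; just; nothing)
import Data.Maybe as Maybe

PVar : Set
PVar = ℕ

data EDT (n : ℕ) : Set where
  𝟘 𝟙  : EDT n
  node : EDT n → PVar → EDT n → EDT n
  ext  : Fin n → EDT n

DT : Set
DT = EDT 0

data ENDT (n : ℕ) : Set where
  𝟘 𝟙  : ENDT n
  node : ENDT n → PVar → ENDT n → ENDT n
  ext  : Fin n → ENDT n
  _∨_  : ENDT n → ENDT n → ENDT n

emb : ∀ {n} → EDT n → ENDT n
emb 𝟘 = 𝟘
emb 𝟙 = 𝟙
emb (node A p B) = node (emb A) p (emb B)
emb (ext i) = ext i

-- A ∨-free set of extension axioms {e_i ↔ E_i}_{i<n}: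
-- E_i is an eDT formula mentioning only e_0 , … , e_(i-1).
-- Built as a snoc list: (Es ▷ E) adds the axiom e_n ↔ E with E : EDT n.
infixl 5 _▷_
data Ext : ℕ → Set where
  []  : Ext 0
  _▷_ : ∀ {n} → Ext n → EDT n → Ext (suc n)

-- view of Fin (suc n): nothing for the last index (= n), just j for inject₁ j
splitLast : ∀ {n} → Fin (suc n) → Maybe (Fin n)
splitLast {zero} zero = nothing
splitLast {suc n} zero = just zero
splitLast {suc n} (suc i) = Maybe.map suc (splitLast i)

weaken : ∀ {n} → EDT n → EDT (suc n)
weaken 𝟘 = 𝟘
weaken 𝟙 = 𝟙
weaken (node A p B) = node (weaken A) p (weaken B)
weaken (ext i) = ext (inject₁ i)

axiom : ∀ {n} → Ext n → Fin n → EDT n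
axiom (Es ▷ E) i with splitLast i
... | nothing = weaken E
... | just j  = weaken (axiom Es j)

mutual
  unf : ∀ {n} → Ext n → EDT n → DT
  unf Es 𝟘 = 𝟘
  unf Es 𝟙 = 𝟙
  unf Es (node A p B) = node (unf Es A) p (unf Es B)
  unf Es (ext i) = unfVar Es i

  unfVar : ∀ {n} → Ext n → Fin n → DT
  unfVar (Es ▷ E) i with splitLast i
  ... | nothing = unf Es E
  ... | just j  = unfVar Es j

infix 4 _⊢_≽_
data _⊢_≽_ {n : ℕ} (Es : Ext n) : ENDT n → ENDT n → Set where
  refl≽ : ∀ {A} → Es ⊢ A ≽ A
  ∨R    : ∀ {A C D} → Es ⊢ A ≽ C → Es ⊢ A ≽ D → Es ⊢ A ≽ (C ∨ D)
  extR  : ∀ {A i} → Es ⊢ A ≽ emb (axiom Es i) → Es ⊢ A ≽ ext i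
  node≽ : ∀ {A B C D p} → Es ⊢ A ≽ C → Es ⊢ B ≽ D →
          Es ⊢ node A p B ≽ node C p D
  ∨L₀   : ∀ {A₀ A₁ B} → Es ⊢ A₀ ≽ B → Es ⊢ (A₀ ∨ A₁) ≽ B
  ∨L₁   : ∀ {A₀ A₁ B} → Es ⊢ A₁ ≽ B → Es ⊢ (A₀ ∨ A₁) ≽ B
  extL  : ∀ {B i} → Es ⊢ emb (axiom Es i) ≽ B → Es ⊢ ext i ≽ B

-- Read both sides through the unfolding relation X ⇓ t on ∨-free eNDT formulas.
-- Every rule of ≽ other than the ∨-rules either unfolds one side by an extension
-- axiom or decomposes both sides at a common head, so ≽ only relates formulas with
-- equal unfoldings. Conversely, two unfoldings to the same tree are matched by
-- unfolding extension variables (extL, extR) and descending through common heads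
-- (node≽), which is a simulation.
module Submission where

open import Defs
open import Data.Nat using (ℕ)
open import Data.Fin using (Fin; zero; suc; inject₁)
open import Data.Maybe using (just; nothing)
open import Function.Bundles using (_⇔_; mk⇔)
open import Relation.Binary.PropositionalEquality
  using (_≡_; refl; sym; cong₂; subst)

private
  variable
    n : ℕ
    Es : Ext n
    E A : EDT n
    X Y : ENDT n
    t u : DT

splitLast-inject₁ : (i : Fin n) → splitLast (inject₁ i) ≡ just i
splitLast-inject₁ {ℕ.suc _} zero = refl
splitLast-inject₁ {ℕ.suc _} (suc i) rewrite splitLast-inject₁ i = refl

axiom-inject₁ : (Es : Ext n) (E : EDT n) (i : Fin n) →
                axiom (Es ▷ E) (inject₁ i) ≡ weaken (axiom Es i)
axiom-inject₁ Es E i rewrite splitLast-inject₁ i = refl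

-- There is no rule for ∨: only ∨-free formulas unfold.
infix 4 _⊢_⇓_
data _⊢_⇓_ (Es : Ext n) : ENDT n → DT → Set where
  𝟘⇓    : Es ⊢ 𝟘 ⇓ 𝟘
  𝟙⇓    : Es ⊢ 𝟙 ⇓ 𝟙
  node⇓ : ∀ {X Y t u p} → Es ⊢ X ⇓ t → Es ⊢ Y ⇓ u → Es ⊢ node X p Y ⇓ node t p u
  ext⇓  : ∀ {i t} → Es ⊢ emb (axiom Es i) ⇓ t → Es ⊢ ext i ⇓ t

⇓-deterministic : Es ⊢ X ⇓ t → Es ⊢ X ⇓ u → t ≡ u
⇓-deterministic 𝟘⇓ 𝟘⇓ = refl
⇓-deterministic 𝟙⇓ 𝟙⇓ = refl
⇓-deterministic (node⇓ d₁ d₂) (node⇓ e₁ e₂) =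
  cong₂ (λ t u → node t _ u) (⇓-deterministic d₁ e₁) (⇓-deterministic d₂ e₂)
⇓-deterministic (ext⇓ d) (ext⇓ e) = ⇓-deterministic d e

⇓-weaken : ∀ {t} → Es ⊢ emb A ⇓ t → (Es ▷ E) ⊢ emb (weaken A) ⇓ t
⇓-weaken {A = 𝟘} 𝟘⇓ = 𝟘⇓
⇓-weaken {A = 𝟙} 𝟙⇓ = 𝟙⇓
⇓-weaken {A = node _ _ _} (node⇓ d₁ d₂) = node⇓ (⇓-weaken d₁) (⇓-weaken d₂)
⇓-weaken {Es = Es} {A = ext i} {E = E} {t = t} (ext⇓ d) =
  ext⇓ (subst (λ C → (Es ▷ E) ⊢ emb C ⇓ t) (sym (axiom-inject₁ Es E i)) (⇓-weaken d))

mutual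
  emb-⇓-unf : (Es : Ext n) (A : EDT n) → Es ⊢ emb A ⇓ unf Es A
  emb-⇓-unf Es 𝟘 = 𝟘⇓
  emb-⇓-unf Es 𝟙 = 𝟙⇓
  emb-⇓-unf Es (node A p B) = node⇓ (emb-⇓-unf Es A) (emb-⇓-unf Es B)
  emb-⇓-unf Es (ext i) = ext⇓ (axiom-⇓-unfVar Es i)

  axiom-⇓-unfVar : (Es : Ext n) (i : Fin n) → Es ⊢ emb (axiom Es i) ⇓ unfVar Es i
  axiom-⇓-unfVar (Es ▷ E) i with splitLast i
  ... | nothing = ⇓-weaken (emb-⇓-unf Es E)
  ... | just j  = ⇓-weaken (axiom-⇓-unfVar Es j)

≽-sound : Es ⊢ X ≽ Y → Es ⊢ X ⇓ t → Es ⊢ Y ⇓ u → t ≡ u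
≽-sound refl≽ d e = ⇓-deterministic d e
≽-sound (extR s) d (ext⇓ e) = ≽-sound s d e
≽-sound (node≽ s₁ s₂) (node⇓ d₁ d₂) (node⇓ e₁ e₂) =
  cong₂ (λ t u → node t _ u) (≽-sound s₁ d₁ e₁) (≽-sound s₂ d₂ e₂)
≽-sound (extL s) (ext⇓ d) e = ≽-sound s d e

≽-complete : Es ⊢ X ⇓ t → Es ⊢ Y ⇓ t → Es ⊢ X ≽ Y
≽-complete (ext⇓ d) e = extL (≽-complete d e)
≽-complete d (ext⇓ e) = extR (≽-complete d e)
≽-complete 𝟘⇓ 𝟘⇓ = refl≽
≽-complete 𝟙⇓ 𝟙⇓ = refl≽
≽-complete (node⇓ d₁ d₂) (node⇓ e₁ e₂) = node≽ (≽-complete d₁ e₁) (≽-complete d₂ e₂)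

proposition3p5 : ∀ (n : ℕ) (Es : Ext n) (A B : EDT n) →
                   (Es ⊢ emb A ≽ emb B) ⇔ (unf Es A ≡ unf Es B)
proposition3p5 n Es A B = mk⇔
  (λ s → ≽-sound s (emb-⇓-unf Es A) (emb-⇓-unf Es B))
  (λ eq → ≽-complete (emb-⇓-unf Es A)
                     (subst (Es ⊢ emb B ⇓_) (sym eq) (emb-⇓-unf Es B)))
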